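{- Let $\delta \geq 2$ and $n$ be integers. Every connected triangle-free graph on $n$ vertices with minimum degree $\delta$ and radius $r$ satisfies $r \geq 2$ and $n \geq 2\delta$; moreover, if $r=3$, then $n \geq 2\delta+2$. Further, for every $n \geq 2\delta$ there exists a connected triangle-free graph on $n$ vertices with minimum degree $\delta$ and radius $2$, and for every $n \geq 2\delta+2$ there exists a connected triangle-free graph on $n$ vertices with minimum degree $\delta$ and radius $3$.
   Context: Graphs are finite and simple. The radius of a connected graph $G$ is $\min_v \max_w d(v,w)$, with $d$ the graph distance. -}

module Defs where

open import Data.Nat using (ℕ; zero; suc; _≤_; _∸_)
open import Data.Fin using (Fin)
open import Data.Bool using (Bool; true; false)
open import Data.List using (List; length; filterᵇ)
open import Data.List using () renaming (allFin to allFinL)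
open import Data.Product using (Σ; ∃; _×_; _,_)
open import Relation.Binary.PropositionalEquality using (_≡_)
open import Relation.Nullary using (¬_)
open import Data.Empty using (⊥)

record Graph (n : ℕ) : Set where
  field
    adj   : Fin n → Fin n → Bool
    sym   : ∀ u v → adj u v ≡ adj v u
    irrefl : ∀ v → adj v v ≡ false

open Graph public

module _ {n : ℕ} (G : Graph n) where

  Adj : Fin n → Fin n → Set
  Adj u v = adj G u v ≡ true

  degree : Fin n → ℕ
  degree v = length (filterᵇ (adj G v) (allFinL n))

  MinDegree : ℕ → Set
  MinDegree δ = (∀ v → δ ≤ degree v) × (∃ λ v → degree v ≡ δ)

  data Within : ℕ → Fin n → Fin n → Set where
    here : ∀ {k v} → Within k v v
    step : ∀ {k u w v} → Adj u w → Within k w v → Within (suc k) u v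

  Connected : Set
  Connected = ∀ u v → ∃ λ k → Within k u v

  TriangleFree : Set
  TriangleFree = ∀ u v w → Adj u v → Adj v w → Adj u w → ⊥

  EccAtMost : Fin n → ℕ → Set
  EccAtMost v k = ∀ w → Within k v w

  Radius : ℕ → Set
  Radius r = (∃ λ v → EccAtMost v r)
           × (∀ k → suc k ≤ r → ∀ v → ¬ EccAtMost v k)

-- Adjacent vertices v, u of a triangle-free graph have disjoint neighbourhoods, so
-- n ≥ deg v + deg u ≥ 2δ. If n ≤ 2δ + 1, at most one vertex x lies outside N(v) ∪ N(u);
-- a neighbour of x lies in N(v) or N(u), and then v or u reaches everything in two steps,
-- so the radius is at most 2. A vertex adjacent to all others would close a triangle with
-- any path v – w – x (one exists as δ ≥ 2), so the radius is at least 2. Sharpness: K(δ, n − δ)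
-- has radius 2, and deleting from K(δ + 1, n − δ − 1) a set of edges that leaves every
-- vertex a non-neighbour on the other side (at distance 3 in a bipartite graph) gives radius 3.

module Submission where

open import Defs hiding (sym)
open import Data.Nat using (ℕ; zero; suc; _≤_; _<_; _+_; _*_; _∸_; _⊓_; z≤n; s≤s; s≤s⁻¹)
open import Data.Nat.Properties
open import Data.Nat.Tactic.RingSolver using (solve-∀)
open import Data.Fin using (Fin; zero; suc; toℕ; fromℕ<)
open import Data.Fin.Properties as Finₚ using (toℕ-fromℕ<; any?)
open import Data.Bool using (Bool; true; false; not; _∨_; if_then_else_)
open import Data.Bool.Properties using (¬-not; not-¬) renaming (_≟_ to _≟ᵇ_)
open import Data.List using (length; filterᵇ; tabulate)
open import Data.Product using (Σ; ∃; _×_; _,_; proj₁; proj₂)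
open import Data.Sum using (_⊎_; inj₁; inj₂; swap; map₁; map₂)
open import Data.Empty using (⊥; ⊥-elim)
open import Function using (_∘_; id; mk⇔)
open import Relation.Nullary using (¬_; Dec; yes; no; does; contradiction; ¬?)
open import Relation.Nullary.Decidable using (_×-dec_; _⊎-dec_; dec-true; dec-false; does-⇔)
open import Relation.Unary using (Pred; Decidable)
open import Relation.Binary.PropositionalEquality

from-does : ∀ {a} {A : Set a} (a? : Dec A) → does a? ≡ true → A
from-does (yes a) _ = a

countᵇ : ∀ {m} → (Fin m → Bool) → ℕ
countᵇ {zero}  g = 0
countᵇ {suc m} g = if g zero then suc (countᵇ (g ∘ suc)) else countᵇ (g ∘ suc)

length-filterᵇ-tabulate : ∀ {a} {A : Set a} {m} (g : A → Bool) (f : Fin m → A) →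
                          length (filterᵇ g (tabulate f)) ≡ countᵇ (g ∘ f)
length-filterᵇ-tabulate {m = zero}  g f = refl
length-filterᵇ-tabulate {m = suc m} g f with g (f zero)
... | true  = cong suc (length-filterᵇ-tabulate g (f ∘ suc))
... | false = length-filterᵇ-tabulate g (f ∘ suc)

degree≡countᵇ : ∀ {n} (G : Graph n) v → degree G v ≡ countᵇ (adj G v)
degree≡countᵇ G v = length-filterᵇ-tabulate (adj G v) id

countᵇ≤ : ∀ {m} (g : Fin m → Bool) → countᵇ g ≤ m
countᵇ≤ {zero}  g = z≤n
countᵇ≤ {suc m} g with g zero
... | true  = s≤s (countᵇ≤ (g ∘ suc))
... | false = m≤n⇒m≤1+n (countᵇ≤ (g ∘ suc))

countᵇ-witness : ∀ {m} (g : Fin m → Bool) → 1 ≤ countᵇ g → ∃ λ x → g x ≡ true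
countᵇ-witness {suc m} g c with g zero in eq
... | true  = zero , eq
... | false = let x , gx = countᵇ-witness (g ∘ suc) c in suc x , gx

countᵇ-witness-≢ : ∀ {m} (g : Fin m → Bool) → 2 ≤ countᵇ g → ∀ v → ∃ λ x → x ≢ v × g x ≡ true
countᵇ-witness-≢ {suc m} g c v with g zero in eq | v
... | true  | suc _ = zero , (λ ()) , eq
... | true  | zero  = let x , gx = countᵇ-witness (g ∘ suc) (s≤s⁻¹ c) in suc x , (λ ()) , gx
... | false | zero  = let x , gx = countᵇ-witness (g ∘ suc) (≤-trans (n≤1+n 1) c) in suc x , (λ ()) , gx
... | false | suc v = let x , x≢v , gx = countᵇ-witness-≢ (g ∘ suc) c v in suc x , x≢v ∘ Finₚ.suc-injective , gx

countᵇ-∨ : ∀ {m} (g h : Fin m → Bool) → (∀ x → g x ≡ true → h x ≡ true → ⊥) →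
           countᵇ (λ x → g x ∨ h x) ≡ countᵇ g + countᵇ h
countᵇ-∨ {zero}  g h disjoint = refl
countᵇ-∨ {suc m} g h disjoint with g zero in e₁ | h zero in e₂
... | true  | true  = ⊥-elim (disjoint zero e₁ e₂)
... | true  | false = cong suc (countᵇ-∨ (g ∘ suc) (h ∘ suc) (disjoint ∘ suc))
... | false | true  = trans (cong suc (countᵇ-∨ (g ∘ suc) (h ∘ suc) (disjoint ∘ suc))) (sym (+-suc _ _))
... | false | false = countᵇ-∨ (g ∘ suc) (h ∘ suc) (disjoint ∘ suc)

countᵇ-full : ∀ {m} (g : Fin m → Bool) → m ≤ countᵇ g → ∀ x → g x ≡ true
countᵇ-full {suc m} g c x with g zero in eq | x
... | true  | zero  = eq
... | true  | suc x = countᵇ-full (g ∘ suc) (s≤s⁻¹ c) x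
... | false | _     = contradiction (countᵇ≤ (g ∘ suc)) (<⇒≱ c)

countᵇ-false-unique : ∀ {m} (g : Fin m → Bool) → m ≤ suc (countᵇ g) →
                      ∀ {a b} → g a ≡ false → g b ≡ false → a ≡ b
countᵇ-false-unique {suc m} g c {a} {b} ga gb with g zero in eq | a | b
... | _     | zero  | zero  = refl
... | true  | suc a | suc b = cong suc (countᵇ-false-unique (g ∘ suc) (s≤s⁻¹ c) ga gb)
... | true  | zero  | _     = ⊥-elim (not-¬ eq ga)
... | true  | suc _ | zero  = ⊥-elim (not-¬ eq gb)
... | false | suc a | _     = ⊥-elim (not-¬ (countᵇ-full (g ∘ suc) (s≤s⁻¹ c) a) ga)
... | false | zero  | suc b = ⊥-elim (not-¬ (countᵇ-full (g ∘ suc) (s≤s⁻¹ c) b) gb)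

count : ∀ {ℓ} {P : Pred ℕ ℓ} → Decidable P → ℕ → ℕ
count P? zero    = 0
count P? (suc m) = if does (P? 0) then suc (count (λ i → P? (suc i)) m) else count (λ i → P? (suc i)) m

countᵇ≡count : ∀ {ℓ} {P : Pred ℕ ℓ} (P? : Decidable P) m →
               countᵇ {m} (λ i → does (P? (toℕ i))) ≡ count P? m
countᵇ≡count P? zero = refl
countᵇ≡count P? (suc m) with does (P? 0)
... | true  = cong suc (countᵇ≡count (λ i → P? (suc i)) m)
... | false = countᵇ≡count (λ i → P? (suc i)) m

count-+ : ∀ {ℓ} {P : Pred ℕ ℓ} (P? : Decidable P) m k →
          count P? (m + k) ≡ count P? m + count (λ t → P? (m + t)) k
count-+ P? zero    k = refl
count-+ P? (suc m) k with does (P? 0)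
... | true  = cong suc (count-+ (λ i → P? (suc i)) m k)
... | false = count-+ (λ i → P? (suc i)) m k

count-prefix : ∀ {ℓ} {P : Pred ℕ ℓ} (P? : Decidable P) {m m′} → m ≤ m′ → count P? m ≤ count P? m′
count-prefix P? {m} {m′} m≤m′ = begin
  count P? m                                         ≤⟨ m≤m+n _ _ ⟩
  count P? m + count (λ t → P? (m + t)) (m′ ∸ m)     ≡⟨ count-+ P? m (m′ ∸ m) ⟨
  count P? (m + (m′ ∸ m))                            ≡⟨ cong (count P?) (m+[n∸m]≡n m≤m′) ⟩
  count P? m′                                        ∎
  where open ≤-Reasoning

count-mono : ∀ {p q} {P : Pred ℕ p} {Q : Pred ℕ q} (P? : Decidable P) (Q? : Decidable Q) m →
             (∀ i → i < m → P i → Q i) → count P? m ≤ count Q? m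
count-mono P? Q? zero    P⇒Q = z≤n
count-mono P? Q? (suc m) P⇒Q with P? 0 | Q? 0
... | yes _  | yes _  = s≤s (count-mono _ _ m λ i i<m → P⇒Q (suc i) (s≤s i<m))
... | yes p  | no ¬q  = contradiction (P⇒Q 0 (s≤s z≤n) p) ¬q
... | no _   | yes _  = m≤n⇒m≤1+n (count-mono _ _ m λ i i<m → P⇒Q (suc i) (s≤s i<m))
... | no _   | no _   = count-mono _ _ m λ i i<m → P⇒Q (suc i) (s≤s i<m)

count-cong : ∀ {p q} {P : Pred ℕ p} {Q : Pred ℕ q} (P? : Decidable P) (Q? : Decidable Q) m →
             (∀ i → i < m → P i → Q i) → (∀ i → i < m → Q i → P i) → count P? m ≡ count Q? m
count-cong P? Q? m P⇒Q Q⇒P = ≤-antisym (count-mono P? Q? m P⇒Q) (count-mono Q? P? m Q⇒P)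

count-none : ∀ {ℓ} {P : Pred ℕ ℓ} (P? : Decidable P) m → (∀ i → i < m → ¬ P i) → count P? m ≡ 0
count-none P? zero    none = refl
count-none P? (suc m) none with P? 0
... | yes p0 = contradiction p0 (none 0 (s≤s z≤n))
... | no _   = count-none _ m λ i i<m → none (suc i) (s≤s i<m)

count-all : ∀ {ℓ} {P : Pred ℕ ℓ} (P? : Decidable P) m → (∀ i → i < m → P i) → count P? m ≡ m
count-all P? zero    all = refl
count-all P? (suc m) all with P? 0
... | yes _  = cong suc (count-all _ m λ i i<m → all (suc i) (s≤s i<m))
... | no ¬p0 = contradiction (all 0 (s≤s z≤n)) ¬p0

count-≢ : ∀ c m → c < suc m → count (λ t → ¬? (t ≟ c)) (suc m) ≡ m
count-≢ zero    m       _ = count-all (λ t → ¬? (suc t ≟ 0)) m λ _ _ ()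
count-≢ (suc c) (suc m) (s≤s c<sm) = cong suc (begin
  count (λ t → ¬? (suc t ≟ suc c)) (suc m) ≡⟨ count-cong (λ t → ¬? (suc t ≟ suc c)) (λ t → ¬? (t ≟ c)) (suc m) (λ _ _ t≢c t≡c → t≢c (cong suc t≡c)) (λ _ _ t≢c st≡sc → t≢c (suc-injective st≡sc)) ⟩
  count (λ t → ¬? (t ≟ c)) (suc m)         ≡⟨ count-≢ c m c<sm ⟩
  m                                        ∎)
  where open ≡-Reasoning

module Properties {n} (G : Graph n) where

  Adj-sym : ∀ {u v} → Adj G u v → Adj G v u
  Adj-sym {u} {v} uv = trans (Graph.sym G v u) uv

  Within-mono : ∀ {k m u v} → k ≤ m → Within G k u v → Within G m u v
  Within-mono _         here        = here
  Within-mono (s≤s k≤m) (step uw w) = step uw (Within-mono k≤m w)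

  Within-++ : ∀ {k m u v w} → Within G k u v → Within G m v w → Within G (k + m) u w
  Within-++ {k} {m} here         vw = Within-mono (m≤n+m m k) vw
  Within-++         (step uu′ u′v) vw = step uu′ (Within-++ u′v vw)

  Within-reverse : ∀ {k u v} → Within G k u v → Within G k v u
  Within-reverse         here         = here
  Within-reverse {suc k} (step uw wv) =
    Within-mono (≤-reflexive (+-comm k 1)) (Within-++ (Within-reverse wv) (step (Adj-sym uw) here))

  Within-1 : ∀ {u v} → Within G 1 u v → u ≡ v ⊎ Adj G u v
  Within-1 here           = inj₁ refl
  Within-1 (step uv here) = inj₂ uv

  EccAtMost⇒Connected : ∀ {c k} → EccAtMost G c k → Connected G
  EccAtMost⇒Connected {k = k} ecc u v = k + k , Within-++ (Within-reverse (ecc u)) (ecc v)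

  radius-intro : ∀ {c k} → EccAtMost G c (suc k) → (∀ v → ∃ λ w → ¬ Within G k v w) → Radius G (suc k)
  radius-intro ecc far = (_ , ecc) , λ j j<sk v ecc-v →
    let w , ¬vw = far v in ¬vw (Within-mono (s≤s⁻¹ j<sk) (ecc-v w))

  Adj-irrefl : ∀ {v} → ¬ Adj G v v
  Adj-irrefl {v} vv = contradiction (trans (sym vv) (Graph.irrefl G v)) λ ()

  neighbour : ∀ {v} → 1 ≤ degree G v → ∃ (Adj G v)
  neighbour {v} d = countᵇ-witness (adj G v) (subst (1 ≤_) (degree≡countᵇ G v) d)

  neighbour-≢ : ∀ {v} → 2 ≤ degree G v → ∀ w → ∃ λ x → x ≢ w × Adj G v x
  neighbour-≢ {v} d = countᵇ-witness-≢ (adj G v) (subst (2 ≤_) (degree≡countᵇ G v) d)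

  cover⇒EccAtMost-2 : ∀ {v u x} → Adj G v u → (∀ w → w ≡ x ⊎ Adj G v w ⊎ Adj G u w) →
                      Within G 2 v x → EccAtMost G v 2
  cover⇒EccAtMost-2 vu cover vx w with cover w
  ... | inj₁ refl      = vx
  ... | inj₂ (inj₁ vw) = step vw here
  ... | inj₂ (inj₂ uw) = step vu (step uw here)

module TriangleFreeBounds {n} (G : Graph n) (triangleFree : TriangleFree G) where
  open Properties G

  ¬EccAtMost-1 : (∀ v → 2 ≤ degree G v) → ∀ v → ¬ EccAtMost G v 1
  ¬EccAtMost-1 deg≥2 v ecc with neighbour (≤-trans (n≤1+n 1) (deg≥2 v))
  ... | w , vw with neighbour-≢ (deg≥2 w) v
  ...   | x , x≢v , wx with Within-1 (ecc x)
  ...     | inj₁ v≡x = x≢v (sym v≡x)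
  ...     | inj₂ vx  = triangleFree v w x vw wx vx

  2≤radius : (∀ v → 2 ≤ degree G v) → ∀ {r} → Radius G r → 2 ≤ r
  2≤radius deg≥2 {zero}        ((v , ecc) , _) = ⊥-elim (¬EccAtMost-1 deg≥2 v (Within-mono z≤n ∘ ecc))
  2≤radius deg≥2 {suc zero}    ((v , ecc) , _) = ⊥-elim (¬EccAtMost-1 deg≥2 v ecc)
  2≤radius _     {suc (suc _)} _               = s≤s (s≤s z≤n)

  private
    module _ {v u} (vu : Adj G v u) where

      neighbourhood : Fin n → Bool
      neighbourhood x = adj G v x ∨ adj G u x

      countᵇ-neighbourhood : countᵇ neighbourhood ≡ degree G v + degree G u
      countᵇ-neighbourhood = begin
        countᵇ neighbourhood                  ≡⟨ countᵇ-∨ (adj G v) (adj G u) (λ x vx ux → triangleFree v u x vu ux vx) ⟩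
        countᵇ (adj G v) + countᵇ (adj G u)   ≡⟨ sym (cong₂ _+_ (degree≡countᵇ G v) (degree≡countᵇ G u)) ⟩
        degree G v + degree G u               ∎
        where open ≡-Reasoning

      covered : ∀ w → neighbourhood w ≡ false ⊎ Adj G v w ⊎ Adj G u w
      covered w with adj G v w | adj G u w
      ... | true  | _     = inj₂ (inj₁ refl)
      ... | false | true  = inj₂ (inj₂ refl)
      ... | false | false = inj₁ refl

  degree+degree≤n : ∀ {v u} → Adj G v u → degree G v + degree G u ≤ n
  degree+degree≤n vu = subst (_≤ n) (countᵇ-neighbourhood vu) (countᵇ≤ (neighbourhood vu))

  cover-but-one : ∀ {v u} → Adj G v u → n ≤ suc (degree G v + degree G u) →
                  ∃ λ x → ∀ w → w ≡ x ⊎ Adj G v w ⊎ Adj G u w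
  cover-but-one {v} vu small with any? (λ x → neighbourhood vu x ≟ᵇ false)
  ... | yes (x , x∉N) = x , λ w → map₁ (λ w∉N → countᵇ-false-unique (neighbourhood vu) small′ w∉N x∉N) (covered vu w)
    where small′ = subst (λ d → n ≤ suc d) (sym (countᵇ-neighbourhood vu)) small
  ... | no ¬uncovered = v , λ w → map₁ (λ w∉N → contradiction (w , w∉N) ¬uncovered) (covered vu w)

  ∃EccAtMost-2 : (∀ x → 1 ≤ degree G x) → ∀ {v u} → Adj G v u → n ≤ suc (degree G v + degree G u) →
                 ∃ λ c → EccAtMost G c 2
  ∃EccAtMost-2 deg≥1 {v} {u} vu small with cover-but-one vu small
  ... | x , cover with neighbour (deg≥1 x)
  ...   | y , xy with cover y
  ...     | inj₁ refl      = ⊥-elim (Adj-irrefl xy)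
  ...     | inj₂ (inj₁ vy) = v , cover⇒EccAtMost-2 vu cover (step vy (step (Adj-sym xy) here))
  ...     | inj₂ (inj₂ uy) = u , cover⇒EccAtMost-2 (Adj-sym vu) (map₂ swap ∘ cover) (step uy (step (Adj-sym xy) here))

lower-bounds : ∀ {δ n} → 2 ≤ δ → (G : Graph n) (r : ℕ) → TriangleFree G → MinDegree G δ → Radius G r →
               (2 ≤ r) × (2 * δ ≤ n) × (r ≡ 3 → 2 * δ + 2 ≤ n)
lower-bounds {δ} {n} 2≤δ G r triangleFree (δ≤deg , _) radius@((v , _) , no-smaller) =
  2≤radius deg≥2 radius , ≤-trans 2δ≤deg (degree+degree≤n vu) , r≡3⇒
  where
  open Properties G
  open TriangleFreeBounds G triangleFree
  deg≥2 : ∀ x → 2 ≤ degree G x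
  deg≥2 x = ≤-trans 2≤δ (δ≤deg x)
  u : Fin n
  u = proj₁ (neighbour (≤-trans (n≤1+n 1) (deg≥2 v)))
  vu : Adj G v u
  vu = proj₂ (neighbour (≤-trans (n≤1+n 1) (deg≥2 v)))
  2δ≤deg : 2 * δ ≤ degree G v + degree G u
  2δ≤deg = ≤-trans (≤-reflexive (cong (δ +_) (+-identityʳ δ))) (+-mono-≤ (δ≤deg v) (δ≤deg u))
  r≡3⇒ : r ≡ 3 → 2 * δ + 2 ≤ n
  r≡3⇒ refl with 2 * δ + 2 ≤? n
  ... | yes big = big
  ... | no ¬big = let c , ecc = ∃EccAtMost-2 (≤-trans (n≤1+n 1) ∘ deg≥2) vu small in contradiction ecc (no-smaller 2 ≤-refl c)
    where small : n ≤ suc (degree G v + degree G u)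
          small = s≤s⁻¹ (≤-trans (≰⇒> ¬big) (≤-trans (+-monoˡ-≤ 2 2δ≤deg) (≤-reflexive (+-comm _ 2))))

module Bipartite {n} (G : Graph n) (side : Fin n → Bool)
                 (Adj⇒side≢ : ∀ {u w} → Adj G u w → side u ≢ side w) where

  side-≡-2-step : ∀ {u v w} → Adj G u v → Adj G v w → side u ≡ side w
  side-≡-2-step uv vw = trans (¬-not (Adj⇒side≢ uv)) (sym (¬-not (≢-sym (Adj⇒side≢ vw))))

  triangleFree : TriangleFree G
  triangleFree u v w uv vw uw = Adj⇒side≢ uw (side-≡-2-step uv vw)

  Within-1-same-side : ∀ {u w} → side u ≡ side w → Within G 1 u w → u ≡ w
  Within-1-same-side _  here           = refl
  Within-1-same-side eq (step uw here) = contradiction eq (Adj⇒side≢ uw)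

  Within-2-other-side : ∀ {u w} → side u ≢ side w → Within G 2 u w → Adj G u w
  Within-2-other-side ne here                     = contradiction refl ne
  Within-2-other-side ne (step uw here)           = uw
  Within-2-other-side ne (step uv (step vw here)) = contradiction (side-≡-2-step uv vw) ne

-- The bipartite graph between [0, p) and [p, n) in which j ≥ p is joined to every i < p except hole j.
module Split (n p : ℕ) (hole : ℕ → ℕ) where

  Joined : ℕ → ℕ → Set
  Joined i j = i < p × p ≤ j × i ≢ hole j

  Adjacent : ℕ → ℕ → Set
  Adjacent i j = Joined i j ⊎ Joined j i

  adjacent? : ∀ i j → Dec (Adjacent i j)
  adjacent? i j = joined? i j ⊎-dec joined? j i
    where joined? : ∀ i j → Dec (Joined i j)
          joined? i j = i <? p ×-dec p ≤? j ×-dec ¬? (i ≟ hole j)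

  ¬Adjacent-refl : ∀ i → ¬ Adjacent i i
  ¬Adjacent-refl i (inj₁ (i<p , p≤i , _)) = <⇒≱ i<p p≤i
  ¬Adjacent-refl i (inj₂ (i<p , p≤i , _)) = <⇒≱ i<p p≤i

  graph : Graph n
  graph = record
    { adj    = λ u w → does (adjacent? (toℕ u) (toℕ w))
    ; sym    = λ u w → does-⇔ (mk⇔ swap swap) (adjacent? (toℕ u) (toℕ w)) (adjacent? (toℕ w) (toℕ u))
    ; irrefl = λ v → dec-false (adjacent? (toℕ v) (toℕ v)) (¬Adjacent-refl (toℕ v))
    }

  open Properties graph

  Adj-lower-upper : ∀ {u w} → toℕ u < p → p ≤ toℕ w → toℕ u ≢ hole (toℕ w) → Adj graph u w
  Adj-lower-upper u<p p≤w u≢hole = dec-true (adjacent? _ _) (inj₁ (u<p , p≤w , u≢hole))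

  ¬Adj-hole : ∀ {u w} → p ≤ toℕ w → toℕ u ≡ hole (toℕ w) → ¬ Adj graph u w
  ¬Adj-hole p≤w u≡hole uw with from-does (adjacent? _ _) uw
  ... | inj₁ (_ , _ , u≢hole) = u≢hole u≡hole
  ... | inj₂ (w<p , _ , _)    = <⇒≱ w<p p≤w

  side : Fin n → Bool
  side u = does (toℕ u <? p)

  side-lower : ∀ {u} → toℕ u < p → side u ≡ true
  side-lower = dec-true (_ <? p)

  side-upper : ∀ {u} → p ≤ toℕ u → side u ≡ false
  side-upper p≤u = dec-false (_ <? p) (≤⇒≯ p≤u)

  lower-upper-side≢ : ∀ {u w} → toℕ u < p → p ≤ toℕ w → side u ≢ side w
  lower-upper-side≢ u<p p≤w eq = contradiction (trans (sym (side-lower u<p)) (trans eq (side-upper p≤w))) λ ()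

  Adj⇒side≢ : ∀ {u w} → Adj graph u w → side u ≢ side w
  Adj⇒side≢ uw with from-does (adjacent? _ _) uw
  ... | inj₁ (u<p , p≤w , _) = lower-upper-side≢ u<p p≤w
  ... | inj₂ (w<p , p≤u , _) = ≢-sym (lower-upper-side≢ w<p p≤u)

  open Bipartite graph side Adj⇒side≢ public

  lower-Within-2 : ∀ {u w} x → toℕ u < p → toℕ w < p → p ≤ toℕ x →
                   toℕ u ≢ hole (toℕ x) → toℕ w ≢ hole (toℕ x) → Within graph 2 u w
  lower-Within-2 x u<p w<p p≤x u≢hole w≢hole =
    step (Adj-lower-upper u<p p≤x u≢hole) (step (Adj-sym (Adj-lower-upper w<p p≤x w≢hole)) here)

  lower-¬Within-2 : ∀ {u w} → toℕ u < p → p ≤ toℕ w → toℕ u ≡ hole (toℕ w) → ¬ Within graph 2 u w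
  lower-¬Within-2 u<p p≤w u≡hole uw =
    ¬Adj-hole p≤w u≡hole (Within-2-other-side (lower-upper-side≢ u<p p≤w) uw)

  degree≡count : ∀ v → degree graph v ≡ count (adjacent? (toℕ v)) n
  degree≡count v = trans (degree≡countᵇ graph v) (countᵇ≡count (adjacent? (toℕ v)) n)

  degree-upper : ∀ v → p ≤ toℕ v → degree graph v ≡ count (λ t → ¬? (t ≟ hole (toℕ v))) p
  degree-upper v p≤v = begin
    degree graph v                                                   ≡⟨ degree≡count v ⟩
    count (adjacent? i) n                                            ≡⟨ cong (count (adjacent? i)) (m+[n∸m]≡n p≤n) ⟨
    count (adjacent? i) (p + (n ∸ p))                                ≡⟨ count-+ (adjacent? i) p (n ∸ p) ⟩
    count (adjacent? i) p + count (λ t → adjacent? i (p + t)) (n ∸ p) ≡⟨ cong₂ _+_ lower-part upper-part ⟩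
    count (λ t → ¬? (t ≟ hole i)) p + 0                              ≡⟨ +-identityʳ _ ⟩
    count (λ t → ¬? (t ≟ hole i)) p                                  ∎
    where
    open ≡-Reasoning
    i : ℕ
    i = toℕ v
    p≤n : p ≤ n
    p≤n = ≤-trans p≤v (<⇒≤ (Finₚ.toℕ<n v))
    lower-part : count (adjacent? i) p ≡ count (λ t → ¬? (t ≟ hole i)) p
    lower-part = count-cong (adjacent? i) (λ t → ¬? (t ≟ hole i)) p
      (λ { t _ (inj₁ (i<p , _ , _)) → contradiction p≤v (<⇒≱ i<p) ; t _ (inj₂ (_ , _ , t≢hole)) → t≢hole })
      (λ t t<p t≢hole → inj₂ (t<p , p≤v , t≢hole))
    upper-part : count (λ t → adjacent? i (p + t)) (n ∸ p) ≡ 0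
    upper-part = count-none (λ t → adjacent? i (p + t)) (n ∸ p)
      (λ { t _ (inj₁ (i<p , _ , _)) → <⇒≱ i<p p≤v ; t _ (inj₂ (p+t<p , _ , _)) → <⇒≱ p+t<p (m≤m+n p t) })

  degree-lower : ∀ v k c → toℕ v < p → p + k ≤ n → (∀ t → t < k → t ≢ c → hole (p + t) ≢ toℕ v) →
                 count (λ t → ¬? (t ≟ c)) k ≤ degree graph v
  degree-lower v k c v<p p+k≤n hole≢v = begin
    count (λ t → ¬? (t ≟ c)) k                                ≤⟨ count-mono (λ t → ¬? (t ≟ c)) (λ t → adjacent? i (p + t)) k
                                                                   (λ t t<k t≢c → inj₁ (v<p , m≤m+n p t , ≢-sym (hole≢v t t<k t≢c))) ⟩
    count (λ t → adjacent? i (p + t)) k                       ≤⟨ m≤n+m _ _ ⟩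
    count (adjacent? i) p + count (λ t → adjacent? i (p + t)) k ≡⟨ count-+ (adjacent? i) p k ⟨
    count (adjacent? i) (p + k)                               ≤⟨ count-prefix (adjacent? i) p+k≤n ⟩
    count (adjacent? i) n                                     ≡⟨ degree≡count v ⟨
    degree graph v                                            ∎
    where
    open ≤-Reasoning
    i : ℕ
    i = toℕ v

-- The hole δ is never a lower vertex, so this is K(δ, n − δ).
module CompleteBipartite {δ n} (2≤δ : 2 ≤ δ) (2δ≤n : 2 * δ ≤ n) where
  open Split n δ (λ _ → δ)
  open Properties graph

  δ+δ≤n : δ + δ ≤ n
  δ+δ≤n = ≤-trans (≤-reflexive (cong (δ +_) (sym (+-identityʳ δ)))) 2δ≤n

  2+δ≤n : 2 + δ ≤ n
  2+δ≤n = ≤-trans (≤-reflexive (+-comm 2 δ)) (≤-trans (+-monoʳ-≤ δ 2≤δ) δ+δ≤n)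

  v₀ vδ : Fin n
  v₀ = fromℕ< (≤-trans (s≤s z≤n) 2+δ≤n)
  vδ = fromℕ< (<⇒≤ 2+δ≤n)

  v₀<δ : toℕ v₀ < δ
  v₀<δ = subst (_< δ) (sym (toℕ-fromℕ< _)) (≤-trans (s≤s z≤n) 2≤δ)

  δ≤vδ : δ ≤ toℕ vδ
  δ≤vδ = ≤-reflexive (sym (toℕ-fromℕ< _))

  count-≢δ : count (λ t → ¬? (t ≟ δ)) δ ≡ δ
  count-≢δ = count-all (λ t → ¬? (t ≟ δ)) δ λ _ → <⇒≢

  minDegree : MinDegree graph δ
  minDegree = δ≤degree , vδ , trans (degree-upper vδ δ≤vδ) count-≢δ
    where
    δ≤degree : ∀ v → δ ≤ degree graph v
    δ≤degree v with toℕ v <? δ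
    ... | yes v<δ = subst (_≤ degree graph v) count-≢δ (degree-lower v δ δ v<δ δ+δ≤n λ _ _ _ → ≢-sym (<⇒≢ v<δ))
    ... | no  v≮δ = ≤-reflexive (sym (trans (degree-upper v (≮⇒≥ v≮δ)) count-≢δ))

  eccentricity : EccAtMost graph v₀ 2
  eccentricity w with toℕ w <? δ
  ... | yes w<δ = lower-Within-2 vδ v₀<δ w<δ δ≤vδ (<⇒≢ v₀<δ) (<⇒≢ w<δ)
  ... | no  w≮δ = step (Adj-lower-upper v₀<δ (≮⇒≥ w≮δ) (<⇒≢ v₀<δ)) here

  partner : ∀ {v} i (q : i < n) → toℕ v ≢ i → side v ≡ does (i <? δ) → ∃ λ w → ¬ Within graph 1 v w
  partner {v} i q v≢i same = fromℕ< q , λ vw → v≢i (trans (cong toℕ (Within-1-same-side same′ vw)) (toℕ-fromℕ< q))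
    where same′ : side v ≡ side (fromℕ< q)
          same′ = trans same (cong (λ j → does (j <? δ)) (sym (toℕ-fromℕ< q)))

  no-vertex-dominates : ∀ v → ∃ λ w → ¬ Within graph 1 v w
  no-vertex-dominates v with toℕ v <? δ | toℕ v ≟ 0 | toℕ v ≟ δ
  ... | yes v<δ | yes v≡0 | _       = partner 1 (≤-trans (<-trans 2≤δ (n<1+n δ)) (<⇒≤ 2+δ≤n))
                                        (λ v≡1 → 0≢1+n (trans (sym v≡0) v≡1)) (trans (side-lower v<δ) (sym (dec-true (1 <? δ) 2≤δ)))
  ... | yes v<δ | no  v≢0 | _       = partner 0 (≤-trans (s≤s z≤n) 2+δ≤n)
                                        v≢0 (trans (side-lower v<δ) (sym (dec-true (0 <? δ) (≤-trans (s≤s z≤n) 2≤δ))))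
  ... | no  v≮δ | _       | yes v≡δ = partner (suc δ) 2+δ≤n
                                        (λ v≡1+δ → 1+n≢n (trans (sym v≡1+δ) v≡δ)) (trans (side-upper (≮⇒≥ v≮δ)) (sym (dec-false (suc δ <? δ) (≤⇒≯ (n≤1+n δ)))))
  ... | no  v≮δ | _       | no  v≢δ = partner δ (<⇒≤ 2+δ≤n)
                                        v≢δ (trans (side-upper (≮⇒≥ v≮δ)) (sym (dec-false (δ <? δ) (n≮n δ))))

  example : Σ (Graph n) λ G → Connected G × TriangleFree G × MinDegree G δ × Radius G 2
  example = graph , EccAtMost⇒Connected eccentricity , triangleFree , minDegree , radius-intro eccentricity no-vertex-dominates

-- Upper vertex δ + 1 + t misses lower vertex min (t, δ): lower i < δ loses only δ + 1 + i,
-- lower δ loses every j ≥ 2δ + 1, and each upper vertex loses one, so all degrees stay ≥ δ.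
module RadiusThree {δ n} (2≤δ : 2 ≤ δ) (2δ+2≤n : 2 * δ + 2 ≤ n) where
  hole : ℕ → ℕ
  hole j = (j ∸ suc δ) ⊓ δ

  open Split n (suc δ) hole
  open Properties graph

  hole<1+δ : ∀ j → hole j < suc δ
  hole<1+δ j = s≤s (m⊓n≤n _ δ)

  hole-shift : ∀ {t} → t ≤ δ → hole (suc δ + t) ≡ t
  hole-shift {t} t≤δ = trans (cong (_⊓ δ) (m+n∸m≡n (suc δ) t)) (m≤n⇒m⊓n≡m t≤δ)

  p+p≤n : suc δ + suc δ ≤ n
  p+p≤n = subst (_≤ n) (eq δ) 2δ+2≤n
    where eq : ∀ δ → 2 * δ + 2 ≡ suc δ + suc δ
          eq = solve-∀

  upper-vertex : ∀ t → t ≤ δ → ∃ λ x → suc δ ≤ toℕ x × hole (toℕ x) ≡ t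
  upper-vertex t t≤δ = fromℕ< q , subst (suc δ ≤_) (sym x≡) (m≤m+n (suc δ) t) ,
                       trans (cong hole x≡) (hole-shift t≤δ)
    where q : suc δ + t < n
          q  = <-≤-trans (+-monoʳ-< (suc δ) (s≤s t≤δ)) p+p≤n
          x≡ : toℕ (fromℕ< q) ≡ suc δ + t
          x≡ = toℕ-fromℕ< q

  lower-vertex : ∀ i → i < suc δ → ∃ λ x → toℕ x ≡ i
  lower-vertex i i<p = fromℕ< q , toℕ-fromℕ< q
    where q : i < n
          q = ≤-trans i<p (≤-trans (m≤m+n (suc δ) (suc δ)) p+p≤n)

  Within-2-via : ∀ {u w} t → t ≤ δ → toℕ u < suc δ → toℕ w < suc δ → toℕ u ≢ t → toℕ w ≢ t → Within graph 2 u w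
  Within-2-via t t≤δ u<p w<p u≢t w≢t =
    let x , p≤x , hole≡t = upper-vertex t t≤δ
    in lower-Within-2 x u<p w<p p≤x (λ e → u≢t (trans e hole≡t)) (λ e → w≢t (trans e hole≡t))

  minDegree : MinDegree graph δ
  minDegree = δ≤degree , v , trans (degree-upper v p≤v) (count-≢ (hole (toℕ v)) δ (hole<1+δ (toℕ v)))
    where
    v : Fin n
    v = proj₁ (upper-vertex 0 z≤n)
    p≤v : suc δ ≤ toℕ v
    p≤v = proj₁ (proj₂ (upper-vertex 0 z≤n))
    δ≤degree : ∀ v → δ ≤ degree graph v
    δ≤degree v with toℕ v <? suc δ
    ... | yes v<p = subst (_≤ degree graph v) (count-≢ (toℕ v) δ v<p)
                      (degree-lower v (suc δ) (toℕ v) v<p p+p≤n λ t t<p t≢v hole≡v →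
                         t≢v (trans (sym (hole-shift (s≤s⁻¹ t<p))) hole≡v))
    ... | no  v≮p = ≤-reflexive (sym (trans (degree-upper v (≮⇒≥ v≮p)) (count-≢ (hole (toℕ v)) δ (hole<1+δ (toℕ v)))))

  v₀ v₂ : Fin n
  v₀ = proj₁ (lower-vertex 0 (s≤s z≤n))
  v₂ = proj₁ (lower-vertex 2 (s≤s 2≤δ))

  v₀<p : toℕ v₀ < suc δ
  v₀<p = subst (_< suc δ) (sym (proj₂ (lower-vertex 0 (s≤s z≤n)))) (s≤s z≤n)

  v₂<p : toℕ v₂ < suc δ
  v₂<p = subst (_< suc δ) (sym (proj₂ (lower-vertex 2 (s≤s 2≤δ)))) (s≤s 2≤δ)

  v₀≢suc : ∀ t → toℕ v₀ ≢ suc t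
  v₀≢suc t e = 0≢1+n (trans (sym (proj₂ (lower-vertex 0 (s≤s z≤n)))) e)

  reach-lower : ∀ {w} → toℕ w < suc δ → Within graph 2 v₀ w
  reach-lower {w} w<p with toℕ w ≟ 1
  ... | yes w≡1 = Within-2-via 2 2≤δ v₀<p w<p (v₀≢suc 1) (λ w≡2 → 1+n≢n (trans (sym w≡2) w≡1))
  ... | no  w≢1 = Within-2-via 1 (≤-trans (n≤1+n 1) 2≤δ) v₀<p w<p (v₀≢suc 0) w≢1

  eccentricity : EccAtMost graph v₀ 3
  eccentricity w with toℕ w <? suc δ
  ... | yes w<p = Within-mono (n≤1+n 2) (reach-lower w<p)
  ... | no  w≮p with toℕ v₀ ≟ hole (toℕ w)
  ...   | no  v₀≢hole = step (Adj-lower-upper v₀<p (≮⇒≥ w≮p) v₀≢hole) here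
  ...   | yes v₀≡hole = Within-++ (reach-lower v₂<p) (step (Adj-lower-upper v₂<p (≮⇒≥ w≮p) v₂≢hole) here)
    where v₂≢hole : toℕ v₂ ≢ hole (toℕ w)
          v₂≢hole e = v₀≢suc 1 (trans v₀≡hole (trans (sym e) (proj₂ (lower-vertex 2 (s≤s 2≤δ)))))

  far : ∀ v → ∃ λ w → ¬ Within graph 2 v w
  far v with toℕ v <? suc δ
  ... | yes v<p = let w , p≤w , hole≡v = upper-vertex (toℕ v) (s≤s⁻¹ v<p)
                  in w , lower-¬Within-2 v<p p≤w (sym hole≡v)
  ... | no  v≮p = let w , w≡hole = lower-vertex (hole (toℕ v)) (hole<1+δ (toℕ v))
                  in w , lower-¬Within-2 (subst (_< suc δ) (sym w≡hole) (hole<1+δ (toℕ v))) (≮⇒≥ v≮p) w≡hole ∘ Within-reverse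

  example : Σ (Graph n) λ G → Connected G × TriangleFree G × MinDegree G δ × Radius G 3
  example = graph , EccAtMost⇒Connected eccentricity , triangleFree , minDegree , radius-intro eccentricity far

proposition3p1 : (δ n : ℕ) → 2 ≤ δ →
    ((G : Graph n) (r : ℕ) → Connected G → TriangleFree G → MinDegree G δ → Radius G r →
        (2 ≤ r) × (2 * δ ≤ n) × (r ≡ 3 → 2 * δ + 2 ≤ n))
    × (2 * δ ≤ n → Σ (Graph n) λ G →
        Connected G × TriangleFree G × MinDegree G δ × Radius G 2)
    × (2 * δ + 2 ≤ n → Σ (Graph n) λ G →
        Connected G × TriangleFree G × MinDegree G δ × Radius G 3)
proposition3p1 δ n 2≤δ = (λ G r _ → lower-bounds 2≤δ G r) , CompleteBipartite.example 2≤δ , RadiusThree.example 2≤δ
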